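{- Let $a,b$ be positive integers with $\gcd(a,b)=1$, $A=\{a,b\}$, and $p\ge0$ an integer. If $S(A)=\{ax+by:x,y\in\mathbb N_0\}$ is an Arf numerical semigroup, then $S_p(A)$ is also Arf, i.e. for all $x,y,z\in S_p(A)$ with $x\ge y\ge z$ one has $x+y-z\in S_p(A)$.
   Context: For $n\ge0$, $d(n;A)$ is the number of $(x,y)\in\mathbb N_0^2$ with $ax+by=n$, and $S_p(A)=\{n\in\mathbb N_0: d(n;A)>p\}$ (so $S_0(A)=S(A)$). A set $T\subseteq\mathbb N_0$ is Arf if for all $x,y,z\in T$ with $x\ge y\ge z$ one has $x+y-z\in T$. -}

module Defs where

open import Data.Nat using (ℕ; _+_; _*_; _∸_; _≤_; _<_; suc)
open import Data.Nat.Properties using (_≟_)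
open import Data.List using (List; length; filter; upTo; cartesianProduct)
open import Data.Product using (_×_; _,_; proj₁; proj₂)
open import Relation.Unary using (Pred)
open import Relation.Binary.PropositionalEquality using (_≡_)
open import Data.Product using (∃)
open import Level using (0ℓ)

-- d(n; {a,b}) : number of (x , y) ∈ ℕ₀² with a*x + b*y = n.
-- For a , b ≥ 1 any solution has x ≤ n and y ≤ n, so we count over
-- the box [0..n] × [0..n].
reps : ℕ → ℕ → ℕ → List (ℕ × ℕ)
reps a b n =
  filter (λ xy → a * proj₁ xy + b * proj₂ xy ≟ n)
         (cartesianProduct (upTo (suc n)) (upTo (suc n)))

d : ℕ → ℕ → ℕ → ℕ
d a b n = length (reps a b n)

Sp : ℕ → ℕ → ℕ → Pred ℕ 0ℓ
Sp a b p n = p < d a b n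

S : ℕ → ℕ → Pred ℕ 0ℓ
S a b n = ∃ λ x → ∃ λ y → a * x + b * y ≡ n

IsArf : Pred ℕ 0ℓ → Set
IsArf T = ∀ x y z → T x → T y → T z → y ≤ x → z ≤ y → T (x + y ∸ z)

-- For coprime a and b, two representations n = a x + b y differ in y by a multiple of a,
-- so their quotients ⌊y / a⌋ are pairwise distinct; if d(n) > p one of them has y ≥ p a,
-- whence n ∸ p a b ∈ S.  Conversely, trading multiples of a in y for multiples of b in x
-- turns one representation of m into p + 1 representations of m + p a b.  Hence
-- S_p(A) = p a b + S(A), and a translate of an Arf set is Arf.
module Submission where

open import Defs
open import Data.Nat using (ℕ; suc; _+_; _*_; _∸_; _/_; _≤_; _<_; _≤?_; s≤s; NonZero; >-nonZero)
open import Data.Nat.Properties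
open import Data.Nat.DivMod using (+-distrib-/-∣ʳ; m*n/n≡m; m/n*n≤m)
open import Data.Nat.Divisibility using (_∣_; divides; divides-refl; ∣m+n∣m⇒∣n; m∣m*n)
open import Data.Nat.Coprimality using (Coprime; gcd≡1⇒coprime; coprime-divisor)
open import Data.Nat.GCD using (gcd)
open import Data.Nat.Solver using (module +-*-Solver)
open import Data.Fin using (Fin; toℕ; fromℕ<)
open import Data.Fin.Properties using (toℕ<n; toℕ-injective; toℕ-fromℕ<; any?; injective⇒≤)
open import Data.List using (List; _∷_; length; lookup)
open import Data.List.Membership.Propositional using (_∈_)
open import Data.List.Membership.Propositional.Properties
  using (∈-lookup; ∈-filter⁺; ∈-filter⁻; ∈-cartesianProduct⁺; ∈-upTo⁺)
open import Data.List.Relation.Unary.Any using (index)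
open import Data.List.Relation.Unary.Any.Properties using (lookup-index)
open import Data.List.Relation.Unary.All as All using ()
open import Data.List.Relation.Unary.AllPairs using (_∷_)
open import Data.List.Relation.Unary.Unique.Propositional using (Unique)
import Data.List.Relation.Unary.Unique.Propositional.Properties as Unique
open import Data.Product using (_×_; _,_; proj₁; proj₂; ∃)
open import Data.Sum using (inj₁; inj₂)
open import Relation.Nullary using (yes; no; contradiction)
open import Relation.Unary using (Pred)
open import Relation.Binary.PropositionalEquality
open import Level using (0ℓ)

open +-*-Solver

Unique⇒lookup-injective : ∀ {A : Set} {xs : List A} → Unique xs →
  ∀ {i j} → lookup xs i ≡ lookup xs j → i ≡ j
Unique⇒lookup-injective {xs = _ ∷ _} (x∉ ∷ _) {Fin.zero}  {Fin.zero}  _  = refl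
Unique⇒lookup-injective {xs = _ ∷ _} (x∉ ∷ _) {Fin.zero}  {Fin.suc j} eq =
  contradiction eq (All.lookup x∉ (∈-lookup j))
Unique⇒lookup-injective {xs = _ ∷ _} (x∉ ∷ _) {Fin.suc i} {Fin.zero}  eq =
  contradiction (sym eq) (All.lookup x∉ (∈-lookup i))
Unique⇒lookup-injective {xs = _ ∷ _} (_ ∷ u)  {Fin.suc i} {Fin.suc j} eq =
  cong Fin.suc (Unique⇒lookup-injective u eq)

bounded-injective⇒≤ : ∀ {m n} (f : Fin m → ℕ) → (∀ i → f i < n) →
  (∀ {i j} → f i ≡ f j → i ≡ j) → m ≤ n
bounded-injective⇒≤ f f<n inj = injective⇒≤ {f = λ i → fromℕ< (f<n i)} λ {i} {j} eq →
  inj (trans (sym (toℕ-fromℕ< (f<n i))) (trans (cong toℕ eq) (toℕ-fromℕ< (f<n j))))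

shift : Pred ℕ 0ℓ → ℕ → Pred ℕ 0ℓ
shift T c n = ∃ λ m → T m × n ≡ m + c

[x+c]+[y+c]∸[z+c]≡[x+y∸z]+c : ∀ x y z c → z ≤ x + y → (x + c) + (y + c) ∸ (z + c) ≡ (x + y ∸ z) + c
[x+c]+[y+c]∸[z+c]≡[x+y∸z]+c x y z c z≤x+y = begin
  (x + c) + (y + c) ∸ (z + c)   ≡⟨ cong₂ _∸_ (solve 3 (λ x y c → (x :+ c) :+ (y :+ c) := c :+ ((x :+ y) :+ c)) refl x y c) (+-comm z c) ⟩
  c + ((x + y) + c) ∸ (c + z)   ≡⟨ [m+n]∸[m+o]≡n∸o c ((x + y) + c) z ⟩
  (x + y) + c ∸ z               ≡⟨ +-∸-comm c z≤x+y ⟩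
  (x + y ∸ z) + c               ∎
  where open ≡-Reasoning

IsArf-shift : ∀ {T} c → IsArf T → IsArf (shift T c)
IsArf-shift c arf _ _ _ (x , x∈T , refl) (y , y∈T , refl) (z , z∈T , refl) y+c≤x+c z+c≤y+c =
  x + y ∸ z , arf x y z x∈T y∈T z∈T (+-cancelʳ-≤ c y x y+c≤x+c) z≤y ,
  [x+c]+[y+c]∸[z+c]≡[x+y∸z]+c x y z c (≤-trans z≤y (m≤n+m y x))
  where
  z≤y : z ≤ y
  z≤y = +-cancelʳ-≤ c z y z+c≤y+c

∈-reps⇒≡ : ∀ {a b n x y} → (x , y) ∈ reps a b n → a * x + b * y ≡ n
∈-reps⇒≡ {a} {b} {n} xy∈ = proj₂ (∈-filter⁻ (λ xy → a * proj₁ xy + b * proj₂ xy ≟ n) xy∈)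

≡⇒∈-reps : ∀ {a b n x y} .{{_ : NonZero a}} .{{_ : NonZero b}} →
  a * x + b * y ≡ n → (x , y) ∈ reps a b n
≡⇒∈-reps {a} {b} {n} {x} {y} refl =
  ∈-filter⁺ (λ xy → a * proj₁ xy + b * proj₂ xy ≟ n)
    (∈-cartesianProduct⁺ (∈-upTo⁺ (s≤s x≤n)) (∈-upTo⁺ (s≤s y≤n))) refl
  where
  x≤n : x ≤ n
  x≤n = ≤-trans (m≤n*m x a) (m≤m+n (a * x) (b * y))
  y≤n : y ≤ n
  y≤n = ≤-trans (m≤n*m y b) (m≤n+m (b * y) (a * x))

reps-unique : ∀ a b n → Unique (reps a b n)
reps-unique a b n = Unique.filter⁺ (λ xy → a * proj₁ xy + b * proj₂ xy ≟ n)
  (Unique.cartesianProduct⁺ (Unique.upTo⁺ (suc n)) (Unique.upTo⁺ (suc n)))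

coprime∧[m*x+n*y≡m*x′+n*[y+t]]⇒m∣t : ∀ {m n x x′ y t} → Coprime m n →
  m * x + n * y ≡ m * x′ + n * (y + t) → m ∣ t
coprime∧[m*x+n*y≡m*x′+n*[y+t]]⇒m∣t {m} {n} {x} {x′} {y} {t} cop eq =
  coprime-divisor cop (∣m+n∣m⇒∣n (subst (m ∣_) m*x≡m*x′+n*t (m∣m*n x)) (m∣m*n x′))
  where
  m*x≡m*x′+n*t : m * x ≡ m * x′ + n * t
  m*x≡m*x′+n*t = +-cancelʳ-≡ (n * y) (m * x) (m * x′ + n * t) (trans eq
    (solve 5 (λ m x′ n y t → m :* x′ :+ n :* (y :+ t) := (m :* x′ :+ n :* t) :+ n :* y) refl m x′ n y t))

d∣n∧[m+n]/d≡m/d⇒n≡0 : ∀ {d m n} .{{_ : NonZero d}} → d ∣ n → (m + n) / d ≡ m / d → n ≡ 0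
d∣n∧[m+n]/d≡m/d⇒n≡0 {d} {m} (divides q refl) eq = cong (_* d) (+-cancelˡ-≡ (m / d) q 0 (begin
  m / d + q           ≡⟨ cong (m / d +_) (m*n/n≡m q d) ⟨
  m / d + q * d / d   ≡⟨ +-distrib-/-∣ʳ m (divides-refl q) ⟨
  (m + q * d) / d     ≡⟨ eq ⟩
  m / d               ≡⟨ +-identityʳ (m / d) ⟨
  m / d + 0           ∎))
  where open ≡-Reasoning

coprime-reps-injective-on-quotient-≤ : ∀ {a b} .{{_ : NonZero a}} → Coprime a b →
  ∀ {x y x′ y′} → a * x + b * y ≡ a * x′ + b * y′ → y / a ≡ y′ / a → y ≤ y′ → (x , y) ≡ (x′ , y′)
coprime-reps-injective-on-quotient-≤ {a} {b} cop {x} {y} {x′} eq q y≤y′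
  with t , refl ← m≤n⇒∃[o]m+o≡n y≤y′
  with refl ← d∣n∧[m+n]/d≡m/d⇒n≡0 (coprime∧[m*x+n*y≡m*x′+n*[y+t]]⇒m∣t cop eq) (sym q)
  = cong₂ _,_ x≡x′ (sym (+-identityʳ y))
  where
  x≡x′ : x ≡ x′
  x≡x′ = *-cancelˡ-≡ x x′ a (+-cancelʳ-≡ (b * y) (a * x) (a * x′)
    (trans eq (cong (λ y′ → a * x′ + b * y′) (+-identityʳ y))))

coprime-reps-injective-on-quotient : ∀ {a b} .{{_ : NonZero a}} → Coprime a b →
  ∀ {x y x′ y′} → a * x + b * y ≡ a * x′ + b * y′ → y / a ≡ y′ / a → (x , y) ≡ (x′ , y′)
coprime-reps-injective-on-quotient cop {y = y} {y′ = y′} eq q with ≤-total y y′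
... | inj₁ y≤y′ = coprime-reps-injective-on-quotient-≤ cop eq q y≤y′
... | inj₂ y′≤y = sym (coprime-reps-injective-on-quotient-≤ cop (sym eq) (sym q) y′≤y)

p≤y/a⇒shift-S : ∀ {a b p n x y} .{{_ : NonZero a}} →
  a * x + b * y ≡ n → p ≤ y / a → shift (S a b) (p * (a * b)) n
p≤y/a⇒shift-S {a} {b} {p} {x = x} {y} refl p≤y/a
  with t , refl ← m≤n⇒∃[o]m+o≡n (≤-trans (*-monoˡ-≤ a p≤y/a) (m/n*n≤m y a)) =
  a * x + b * t , (x , t , refl) ,
  solve 5 (λ a b p x t → a :* x :+ b :* (p :* a :+ t) := (a :* x :+ b :* t) :+ p :* (a :* b)) refl a b p x t

Sp⊆shift-S : ∀ {a b p n} .{{_ : NonZero a}} → Coprime a b →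
  Sp a b p n → shift (S a b) (p * (a * b)) n
Sp⊆shift-S {a} {b} {p} {n} cop p<d with any? (λ i → p ≤? proj₂ (lookup (reps a b n) i) / a)
... | yes (i , p≤y/a) = p≤y/a⇒shift-S (∈-reps⇒≡ {a} {b} (∈-lookup i)) p≤y/a
... | no ∄i = contradiction (bounded-injective⇒≤ quotient (λ i → ≰⇒> λ p≤ → ∄i (i , p≤)) quotient-injective) (<⇒≱ p<d)
  where
  R = reps a b n
  quotient : Fin (length R) → ℕ
  quotient i = proj₂ (lookup R i) / a
  quotient-injective : ∀ {i j} → quotient i ≡ quotient j → i ≡ j
  quotient-injective {i} {j} eq = Unique⇒lookup-injective (reps-unique a b n)
    (coprime-reps-injective-on-quotient cop
      (trans (∈-reps⇒≡ {a} {b} (∈-lookup i)) (sym (∈-reps⇒≡ {a} {b} (∈-lookup j)))) eq)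

shift-S⊆Sp : ∀ {a b p n} .{{_ : NonZero a}} .{{_ : NonZero b}} →
  shift (S a b) (p * (a * b)) n → Sp a b p n
shift-S⊆Sp {a} {b} {p} (_ , (x , y , refl) , refl) = injective⇒≤ {f = λ i → index (trade∈reps i)} index-injective
  where
  n = a * x + b * y + p * (a * b)
  trade : Fin (suc p) → ℕ × ℕ
  trade i = x + b * toℕ i , y + a * (p ∸ toℕ i)
  trade-represents : ∀ i → a * proj₁ (trade i) + b * proj₂ (trade i) ≡ n
  trade-represents i = begin
    a * (x + b * i′) + b * (y + a * (p ∸ i′))
      ≡⟨ solve 6 (λ a b x y i k → a :* (x :+ b :* i) :+ b :* (y :+ a :* k) := (a :* x :+ b :* y) :+ (i :+ k) :* (a :* b)) refl a b x y i′ (p ∸ i′) ⟩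
    a * x + b * y + (i′ + (p ∸ i′)) * (a * b)
      ≡⟨ cong (λ k → a * x + b * y + k * (a * b)) (m+[n∸m]≡n (≤-pred (toℕ<n i))) ⟩
    n ∎
    where
    open ≡-Reasoning
    i′ = toℕ i
  trade∈reps : ∀ i → trade i ∈ reps a b n
  trade∈reps i = ≡⇒∈-reps (trade-represents i)
  index-injective : ∀ {i j} → index (trade∈reps i) ≡ index (trade∈reps j) → i ≡ j
  index-injective {i} {j} eq = toℕ-injective (*-cancelˡ-≡ (toℕ i) (toℕ j) b (+-cancelˡ-≡ x _ _ (cong proj₁ trade-i≡trade-j)))
    where
    trade-i≡trade-j : trade i ≡ trade j
    trade-i≡trade-j = trans (lookup-index (trade∈reps i))
      (trans (cong (lookup (reps a b n)) eq) (sym (lookup-index (trade∈reps j))))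

proposition4 : (a b p : ℕ) → 0 < a → 0 < b → gcd a b ≡ 1 →
    IsArf (S a b) → IsArf (Sp a b p)
proposition4 a b p a>0 b>0 gcd≡1 S-Arf x y z x∈ y∈ z∈ y≤x z≤y =
  shift-S⊆Sp (IsArf-shift (p * (a * b)) S-Arf x y z (shifted x∈) (shifted y∈) (shifted z∈) y≤x z≤y)
  where
  instance
    a≢0 : NonZero a
    a≢0 = >-nonZero a>0
    b≢0 : NonZero b
    b≢0 = >-nonZero b>0
  shifted : ∀ {n} → Sp a b p n → shift (S a b) (p * (a * b)) n
  shifted = Sp⊆shift-S (gcd≡1⇒coprime gcd≡1)
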